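{- Let $n,j$ be integers with $4\mid n$, $j\ge 2$ even and $j\le n$ (i.e. $\nu_2(n)\ge2$, $\nu_2(j)\ge1$). Then \[ |\mathrm{Orb}(C_n,\mathrm{Neck}(n,j))_2^f| = \frac{1}{2}\binom{\frac n2}{\frac j2}+ \frac12 |\mathrm{Orb}_{odd}(C_n,\mathrm{Neck}(n,j))^f|. \]
   Context: Place $n$ beads at the points $P_m=R^m(0,1)\in\mathbb R^2$, $m\in\mathbb Z/n$, $R$ the counterclockwise rotation by $2\pi/n$. $\mathrm{Neck}(n,j)$ is the set of colorings of these positions with $j$ blue and $n-j$ red beads. $C_n$ acts by rotation and the flip $f$ by reflection in the vertical axis ($P_m\mapsto P_{ -m}$); $f$ acts on the set $\mathrm{Orb}(C_n,\mathrm{Neck}(n,j))$ of rotation orbits, and a superscript $f$ denotes $f$-fixed orbits; the subscript $odd$ denotes orbits of odd cardinality. A line $\sigma$ through the origin is a symmetry axis of a necklace $l$ if reflection in $\sigma$ preserves the set of blue positions of $l$; it is of type 2 if it contains at least one of the points $P_m$. $\mathrm{Orb}(C_n,\mathrm{Neck}(n,j))^f_2$ is the set of $f$-fixed orbits having a representative with a type 2 symmetry axis. -}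

module Defs where

open import Data.Bool using (Bool; true; false)
open import Data.Bool.Properties using () renaming (_≟_ to _≟B_)
open import Data.Nat using (ℕ; zero; suc; _+_; _*_; _∸_; NonZero; _≟_)
open import Data.Nat.DivMod using (_%_; m%n<n)
open import Data.Nat.Divisibility using (_∣_; _∣?_)
open import Relation.Nullary.Decidable using (¬?)
open import Data.Fin using (Fin; toℕ; fromℕ<)
open import Data.Fin.Properties using (any?)
open import Data.Vec using (Vec; []; _∷_; tabulate; lookup)
open import Data.Vec.Properties using (≡-dec)
open import Data.List using (List; []; _∷_; map; _++_; length; filter; deduplicate; allFin)
open import Data.Product using (Σ; ∃; _×_; _,_)
open import Relation.Nullary using (Dec; yes; no; ¬_)
open import Relation.Nullary.Decidable using (_×-dec_)
open import Relation.Binary.PropositionalEquality using (_≡_)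
open import Relation.Binary.Definitions using (DecidableEquality)

-- A necklace on n beads: entry i is the colour of the bead at P_i
-- (true = blue, false = red).
Coloring : ℕ → Set
Coloring n = Vec Bool n

_≟C_ : ∀ {n} → DecidableEquality (Coloring n)
_≟C_ = ≡-dec _≟B_

blue : ∀ {n} → Coloring n → ℕ
blue []           = 0
blue (true  ∷ v)  = suc (blue v)
blue (false ∷ v)  = blue v

allColorings : (n : ℕ) → List (Coloring n)
allColorings zero    = [] ∷ []
allColorings (suc n) = map (true ∷_) (allColorings n) ++ map (false ∷_) (allColorings n)

Neck : (n j : ℕ) → List (Coloring n)
Neck n j = filter (λ v → blue v ≟ j) (allColorings n)

module _ {n : ℕ} .{{_ : NonZero n}} where

  pos : ℕ → Fin n
  pos m = fromℕ< (m%n<n m n)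

  -- R^k : the bead at P_i is moved to P_{i+k};
  -- so the new colour at P_i is the old colour at P_{i-k}
  rot : ℕ → Coloring n → Coloring n
  rot k v = tabulate (λ i → lookup v (pos (toℕ i + (n ∸ k % n))))

  flip : Coloring n → Coloring n
  flip v = tabulate (λ i → lookup v (pos (n ∸ toℕ i)))

  -- reflection s_c : P_m ↦ P_{c-m} (c ∈ ℤ/n); these are exactly the
  -- reflections in lines through the origin preserving {P_m}
  refl : Fin n → Coloring n → Coloring n
  refl c v = tabulate (λ i → lookup v (pos (toℕ c + (n ∸ toℕ i))))

  -- the axis of s_c contains P_m  iff  s_c fixes P_m, i.e. c - m ≡ m (mod n)
  AxisContains : Fin n → Fin n → Set
  AxisContains c m = pos (toℕ c + (n ∸ toℕ m)) ≡ m

  IsSymmetryAxis : Fin n → Coloring n → Set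
  IsSymmetryAxis c l = refl c l ≡ l

  HasType2Axis : Coloring n → Set
  HasType2Axis l = ∃ λ (c : Fin n) → IsSymmetryAxis c l × (∃ λ (m : Fin n) → AxisContains c m)

  hasType2Axis? : (l : Coloring n) → Dec (HasType2Axis l)
  hasType2Axis? l = any? (λ c → (refl c l ≟C l) ×-dec any? (λ m → pos (toℕ c + (n ∸ toℕ m)) Data.Fin.≟ m))

  SameOrbit : Coloring n → Coloring n → Set
  SameOrbit v w = ∃ λ (k : Fin n) → rot (toℕ k) v ≡ w

  sameOrbit? : (v w : Coloring n) → Dec (SameOrbit v w)
  sameOrbit? v w = any? (λ k → rot (toℕ k) v ≟C w)

  -- the C_n-orbit of v is f-fixed: f(v) lies in the orbit of v
  FFixed : Coloring n → Set
  FFixed v = SameOrbit v (flip v)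

  fFixed? : (v : Coloring n) → Dec (FFixed v)
  fFixed? v = sameOrbit? v (flip v)

  HasType2Rep : Coloring n → Set
  HasType2Rep v = ∃ λ (k : Fin n) → HasType2Axis (rot (toℕ k) v)

  hasType2Rep? : (v : Coloring n) → Dec (HasType2Rep v)
  hasType2Rep? v = any? (λ k → hasType2Axis? (rot (toℕ k) v))

  orbitCard : Coloring n → ℕ
  orbitCard v = length (deduplicate _≟C_ (map (λ k → rot (toℕ k) v) (allFin n)))

  numOrbits : List (Coloring n) → ℕ
  numOrbits L = length (deduplicate sameOrbit? L)

  numOrbF2 : ℕ → ℕ
  numOrbF2 j = numOrbits (filter (λ v → fFixed? v ×-dec hasType2Rep? v) (Neck n j))

  numOrbOddF : ℕ → ℕ
  numOrbOddF j = numOrbits (filter (λ v → fFixed? v ×-dec ¬? (2 ∣? orbitCard v)) (Neck n j))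

{-# OPTIONS --safe #-}
-- Double counting over rotation orbits.  If the orbit of a necklace r is f-fixed, some
-- reflection s_c₀ fixes r; let d be the least period of r, so that the orbit has d elements.
-- The reflections fixing r are the s_c with c ≡ c₀ (mod d), those of type 2 are the s_2h,
-- and the rotation of r by a is f-fixed iff 2a ≡ c₀ (mod d).
-- So an f-fixed orbit with d odd is odd, of type 2, and contains one f-fixed necklace; with d
-- even it is even, and it is of type 2 and contains two f-fixed necklaces if c₀ is even, and
-- is of neither kind and contains none if c₀ is odd.  Summing over the orbits gives, for all n,
--   2 |Orb(C_n, Neck(n,j))^f_2| = |{l ∈ Neck(n,j) | f l = l}| + |Orb_odd(C_n, Neck(n,j))^f|.
-- For n = 2m and j = 2t an f-fixed necklace reads a w b (reverse w) from P_0 on, and its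
-- number of blue beads is even only if a = b; so there are (m C t) of them.
module Submission where

open import Level using (Level; 0ℓ)
open import Algebra.Bundles using (AbelianGroup)
open import Algebra.Structures using (IsAbelianGroup)
open import Data.Bool using (Bool; true; false)
open import Data.Empty using (⊥; ⊥-elim)
open import Data.Fin using (Fin; toℕ; fromℕ<; inject; inject₁; fromℕ; opposite) renaming (zero to fzero; suc to fsuc)
open import Data.Fin.Properties using (toℕ-fromℕ<; fromℕ<-cong; fromℕ<-toℕ; toℕ<n; toℕ-inject₁; toℕ-fromℕ; toℕ-injective; toℕ-inject; opposite-prop; opposite-involutive; ¬∀⟶∃¬-smallest)
open import Data.List using (List; []; _∷_; map; filter; length; deduplicate; allFin; upTo; applyUpTo)
import Data.List as List
import Data.List.Properties as List
open import Data.List.Properties using (filter-accept; filter-reject; length-filter; filter-none; filter-≐; filter-++; length-++; length-applyUpTo; map-upTo)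
open import Data.List.Membership.Propositional using (_∈_)
open import Data.List.Membership.Propositional.Properties using (∈-map⁺; ∈-map⁻; ∈-++⁺ˡ; ∈-++⁺ʳ; ∈-filter⁺; ∈-filter⁻; ∈-deduplicate⁺; ∈-deduplicate⁻; ∈-allFin; ∈-upTo⁺; ∈-upTo⁻; ∈-applyUpTo⁺; ∈-applyUpTo⁻)
open import Data.List.Membership.Propositional.Properties.WithK using (unique∧set⇒bag)
open import Data.List.Relation.Binary.BagAndSetEquality using (∼bag⇒↭)
open import Data.List.Relation.Binary.Permutation.Propositional.Properties using (↭-length)
open import Data.List.Relation.Unary.All using (All; []; _∷_)
import Data.List.Relation.Unary.All as All
open import Data.List.Relation.Unary.All.Properties using (all-filter; deduplicate⁺)
import Data.List.Relation.Unary.AllPairs as AllPairs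
open import Data.List.Relation.Unary.Any using (here; there)
open import Data.List.Relation.Unary.Unique.Propositional using (Unique)
import Data.List.Relation.Unary.Unique.Propositional.Properties as Unique
open import Data.Nat using (ℕ; zero; suc; pred; _+_; _*_; _∸_; _/_; _<_; _≤_; _≟_; _<?_; NonZero; s≤s; z≤n; s≤s⁻¹)
open import Data.Nat.Combinatorics using (_C_; nCk+nC[k+1]≡[n+1]C[k+1])
open import Data.Nat.DivMod using (_%_; %-distribˡ-+; %-remove-+ʳ; m%n%n≡m%n; n%n≡0; m%n≤n; m%n<n; m<n⇒m%n≡m; m≤n⇒m%n≡m; m*n%n≡0; m*n/n≡m; m≡m%n+[m/n]*n; m≤n⇒[n∸m]%m≡n%m; [m+n]%n≡m%n; m∣n⇒o%n%m≡o%m)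
open import Data.Nat.Divisibility using (_∣_; _∣?_; divides; ∣-trans; m%n≡0⇒n∣m)
open import Data.Nat.ListAction using (sum)
open import Data.Nat.Properties using (≤-refl; ≤-trans; ≤-reflexive; ≤-total; ≤-<-trans; <-irrefl; <-trans; ≮⇒≥; m≤m+n; m≤n⇒∃[o]m+o≡n; +-suc; +-assoc; +-comm; +-identityʳ; +-commutativeSemigroup; +-cancelˡ-≡; +-cancelʳ-<; +-mono-<; +-monoˡ-<; *-comm; *-distribˡ-+; *-cancelˡ-≡; *-cancelˡ-<; m∸n+n≡m; m∸n≤m; +-∸-assoc; suc-injective; suc-pred; even≢odd; m<n⇒n≢0)
open import Algebra.Properties.CommutativeSemigroup +-commutativeSemigroup using (interchange; x∙yz≈y∙xz; x∙yz≈xz∙y; xy∙z≈xz∙y)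
open import Data.Product using (∃; _×_; _,_; proj₁; proj₂; uncurry)
open import Data.Sum using (_⊎_; inj₁; inj₂)
open import Data.Vec using (Vec; []; _∷_; _∷ʳ_; _++_; reverse; lookup; tabulate; toList; splitAt)
open import Data.Vec.Properties using (lookup∘tabulate; tabulate∘lookup; tabulate-cong; reverse-∷; reverse-involutive; toList-injective; toList-++; toList-reverse; cast-is-id; ++-injectiveˡ; ++-injectiveʳ; ∷-injective; ∷-injectiveʳ)
open import Function using (_∘_; mk⇔)
open import Relation.Binary using (Rel; DecSetoid)
import Relation.Binary.Construct.On as On
open import Relation.Binary.Definitions using (_Respects_)
open import Relation.Binary.PropositionalEquality using (_≡_; _≢_; refl; sym; trans; cong; cong₂; subst; subst₂; isEquivalence; module ≡-Reasoning)
open import Relation.Nullary using (Dec; yes; no; ¬_; ¬?; contradiction)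
open import Relation.Nullary.Decidable using (_×-dec_; decidable-stable)
open import Relation.Unary using (Pred; Decidable; _⊆_)
open import Defs hiding (refl)

private variable
  a p q : Level

𝟙 : {P : Set p} → Dec P → ℕ
𝟙 (yes _) = 1
𝟙 (no _)  = 0

𝟙-yes : {P : Set p} (P? : Dec P) → P → 𝟙 P? ≡ 1
𝟙-yes (yes _) _  = refl
𝟙-yes (no ¬P) P  = contradiction P ¬P

𝟙-no : {P : Set p} (P? : Dec P) → ¬ P → 𝟙 P? ≡ 0
𝟙-no (yes P) ¬P = contradiction P ¬P
𝟙-no (no _)  _  = refl

module _ {A : Set a} where

  unique∧set⇒length≡ : {xs ys : List A} → Unique xs → Unique ys →
                        (∀ {x} → x ∈ xs → x ∈ ys) → (∀ {x} → x ∈ ys → x ∈ xs) →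
                        length xs ≡ length ys
  unique∧set⇒length≡ !xs !ys xs⊆ys ys⊆xs =
    ↭-length (∼bag⇒↭ (unique∧set⇒bag !xs !ys (mk⇔ xs⊆ys ys⊆xs)))

  length-filter-∷ : {P : Pred A p} (P? : Decidable P) →
                    ∀ x xs → length (filter P? (x ∷ xs)) ≡ 𝟙 (P? x) + length (filter P? xs)
  length-filter-∷ P? x xs with P? x
  ... | yes _ = refl
  ... | no _  = refl

  length-filter-map : ∀ {b} {B : Set b} {P : Pred B p} (P? : Decidable P) (f : A → B) xs →
                      length (filter P? (map f xs)) ≡ length (filter (P? ∘ f) xs)
  length-filter-map P? f []       = refl
  length-filter-map P? f (x ∷ xs) with P? (f x)
  ... | yes _ = cong suc (length-filter-map P? f xs)
  ... | no _  = length-filter-map P? f xs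

  module _ {P : Pred A p} (P? : Decidable P) {Q : Pred A q} (Q? : Decidable Q) where

    filter-comm : ∀ xs → filter P? (filter Q? xs) ≡ filter Q? (filter P? xs)
    filter-comm []       = refl
    filter-comm (x ∷ xs) with Q? x
    ... | yes Qx with P? x
    ...   | yes _ = trans (cong (x ∷_) (filter-comm xs)) (sym (filter-accept Q? Qx))
    ...   | no _  = filter-comm xs
    filter-comm (x ∷ xs) | no ¬Qx with P? x
    ...   | yes _ = trans (filter-comm xs) (sym (filter-reject Q? ¬Qx))
    ...   | no _  = filter-comm xs

    filter-absorbʳ : P ⊆ Q → ∀ xs → filter P? (filter Q? xs) ≡ filter P? xs
    filter-absorbʳ P⊆Q []       = refl
    filter-absorbʳ P⊆Q (x ∷ xs) with Q? x
    ... | yes _ with P? x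
    ...   | yes _ = cong (x ∷_) (filter-absorbʳ P⊆Q xs)
    ...   | no _  = filter-absorbʳ P⊆Q xs
    filter-absorbʳ P⊆Q (x ∷ xs) | no ¬Qx with P? x
    ...   | yes Px = contradiction (P⊆Q Px) ¬Qx
    ...   | no _   = filter-absorbʳ P⊆Q xs

    length-filter-split : ∀ xs → length (filter P? xs) ≡
                          length (filter P? (filter Q? xs)) + length (filter P? (filter (¬? ∘ Q?) xs))
    length-filter-split []       = refl
    length-filter-split (x ∷ xs) with Q? x
    ... | yes _ with P? x
    ...   | yes _ = cong suc (length-filter-split xs)
    ...   | no _  = length-filter-split xs
    length-filter-split (x ∷ xs) | no _ with P? x
    ...   | yes _ = trans (cong suc (length-filter-split xs)) (sym (+-suc _ _))
    ...   | no _  = length-filter-split xs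

    count-double : (f : A → ℕ) → ∀ {xs} → All (λ x → 2 * 𝟙 (P? x) ≡ f x + 𝟙 (Q? x)) xs →
                   2 * length (filter P? xs) ≡ sum (map f xs) + length (filter Q? xs)
    count-double f []                  = refl
    count-double f {x ∷ xs} (eq ∷ eqs) = begin
      2 * length (filter P? (x ∷ xs))
        ≡⟨ cong (2 *_) (length-filter-∷ P? x xs) ⟩
      2 * (𝟙 (P? x) + length (filter P? xs))
        ≡⟨ *-distribˡ-+ 2 (𝟙 (P? x)) _ ⟩
      2 * 𝟙 (P? x) + 2 * length (filter P? xs)
        ≡⟨ cong₂ _+_ eq (count-double f eqs) ⟩
      (f x + 𝟙 (Q? x)) + (sum (map f xs) + length (filter Q? xs))
        ≡⟨ interchange (f x) _ _ _ ⟩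
      sum (map f (x ∷ xs)) + (𝟙 (Q? x) + length (filter Q? xs))
        ≡⟨ cong (sum (map f (x ∷ xs)) +_) (length-filter-∷ Q? x xs) ⟨
      sum (map f (x ∷ xs)) + length (filter Q? (x ∷ xs))
        ∎
      where open ≡-Reasoning

module Classes {a ℓ} (S : DecSetoid a ℓ) where

  open DecSetoid S using (_≈_) renaming (Carrier to A; _≟_ to _≈?_; refl to ≈-refl; sym to ≈-sym; trans to ≈-trans)

  dedup : List A → List A
  dedup = deduplicate _≈?_

  private
    ≉-respects : ∀ x → (λ y → ¬ x ≈ y) Respects _≈_
    ≉-respects x y≈z x≉y x≈z = x≉y (≈-trans x≈z (≈-sym y≈z))

  dedup-filter : {P : Pred A p} (P? : Decidable P) → P Respects _≈_ →
                 ∀ xs → dedup (filter P? xs) ≡ filter P? (dedup xs)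
  dedup-filter P? resp []       = refl
  dedup-filter P? resp (x ∷ xs) with P? x
  ... | yes _  = cong (x ∷_) (begin
    filter (¬? ∘ (x ≈?_)) (dedup (filter P? xs))    ≡⟨ cong (filter (¬? ∘ (x ≈?_))) (dedup-filter P? resp xs) ⟩
    filter (¬? ∘ (x ≈?_)) (filter P? (dedup xs))    ≡⟨ filter-comm (¬? ∘ (x ≈?_)) P? (dedup xs) ⟩
    filter P? (filter (¬? ∘ (x ≈?_)) (dedup xs))    ∎)
    where open ≡-Reasoning
  ... | no ¬Px = trans (dedup-filter P? resp xs)
    (sym (filter-absorbʳ P? (¬? ∘ (x ≈?_)) (λ Py x≈y → ¬Px (resp (≈-sym x≈y) Py)) (dedup xs)))

  module _ {P : Pred A p} (P? : Decidable P) where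

    class-size : List A → A → ℕ
    class-size xs r = length (filter P? (filter (r ≈?_) xs))

    private
      class-size-≉ : ∀ x xs {r} → ¬ x ≈ r →
                     class-size (filter (¬? ∘ (x ≈?_)) xs) r ≡ class-size (x ∷ xs) r
      class-size-≉ x xs {r} x≉r = cong (length ∘ filter P?) (begin
        filter (r ≈?_) (filter (¬? ∘ (x ≈?_)) xs)  ≡⟨ filter-absorbʳ (r ≈?_) (¬? ∘ (x ≈?_)) (λ r≈y → ≉-respects x r≈y x≉r) xs ⟩
        filter (r ≈?_) xs                         ≡⟨ filter-reject (r ≈?_) (x≉r ∘ ≈-sym) ⟨
        filter (r ≈?_) (x ∷ xs)                   ∎)
        where open ≡-Reasoning

      -- Recursion on a length bound: the recursive call is on a filtered tail.
      length-filter≡sum-classes-≤ : ∀ k xs → length xs ≤ k →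
                                    length (filter P? xs) ≡ sum (map (class-size xs) (dedup xs))
      length-filter≡sum-classes-≤ _       []       _            = refl
      length-filter≡sum-classes-≤ (suc k) (x ∷ xs) (s≤s |xs|≤k) = begin
        length (filter P? (x ∷ xs))
          ≡⟨ length-filter-split P? (x ≈?_) (x ∷ xs) ⟩
        [x] + length (filter P? (filter (¬? ∘ (x ≈?_)) (x ∷ xs)))
          ≡⟨ cong (λ ys → [x] + length (filter P? ys)) (filter-reject (¬? ∘ (x ≈?_)) (λ x≉x → x≉x ≈-refl)) ⟩
        [x] + length (filter P? xs′)
          ≡⟨ cong ([x] +_) (length-filter≡sum-classes-≤ k xs′ (≤-trans (length-filter _ xs) |xs|≤k)) ⟩
        [x] + sum (map (class-size xs′) (dedup xs′))
          ≡⟨ cong ([x] +_) (sum-map-cong (deduplicate⁺ _≈?_ (all-filter (¬? ∘ (x ≈?_)) xs))) ⟩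
        [x] + sum (map (class-size (x ∷ xs)) (dedup xs′))
          ≡⟨ cong (λ ys → [x] + sum (map (class-size (x ∷ xs)) ys)) (dedup-filter (¬? ∘ (x ≈?_)) (≉-respects x) xs) ⟩
        sum (map (class-size (x ∷ xs)) (dedup (x ∷ xs)))
          ∎
        where
        open ≡-Reasoning
        [x] = class-size (x ∷ xs) x
        xs′ = filter (¬? ∘ (x ≈?_)) xs
        sum-map-cong : ∀ {rs} → All (λ r → ¬ x ≈ r) rs →
                       sum (map (class-size xs′) rs) ≡ sum (map (class-size (x ∷ xs)) rs)
        sum-map-cong []           = refl
        sum-map-cong (x≉r ∷ x≉rs) = cong₂ _+_ (class-size-≉ x xs x≉r) (sum-map-cong x≉rs)

    length-filter≡sum-classes : ∀ xs → length (filter P? xs) ≡ sum (map (class-size xs) (dedup xs))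
    length-filter≡sum-classes xs = length-filter≡sum-classes-≤ (length xs) xs ≤-refl

-- ℕ modulo d as an abelian group

module Modular (d : ℕ) .{{_ : NonZero d}} where

  infix 4 _≈_
  _≈_ : Rel ℕ 0ℓ
  a ≈ b = a % d ≡ b % d

  infix 8 -_
  -_ : ℕ → ℕ
  - a = d ∸ a % d

  ≡⇒≈ : ∀ {a b} → a ≡ b → a ≈ b
  ≡⇒≈ = cong (_% d)

  %≈ : ∀ a → a % d ≈ a
  %≈ a = m%n%n≡m%n a d

  +-cong : ∀ {a a′ b b′} → a ≈ a′ → b ≈ b′ → a + b ≈ a′ + b′
  +-cong {a} {a′} {b} {b′} a≈a′ b≈b′ = trans (%-distribˡ-+ a b d)
    (trans (cong₂ (λ x y → (x + y) % d) a≈a′ b≈b′) (sym (%-distribˡ-+ a′ b′ d)))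

  +-congˡ : ∀ a {b c} → b ≈ c → a + b ≈ a + c
  +-congˡ a = +-cong (refl {x = a % d})

  +-congʳ : ∀ c {a b} → a ≈ b → a + c ≈ b + c
  +-congʳ c a≈b = +-cong a≈b (refl {x = c % d})

  -‿cong : ∀ {a b} → a ≈ b → - a ≈ - b
  -‿cong = cong (λ x → (d ∸ x) % d)

  d≈0 : d ≈ 0
  d≈0 = trans (n%n≡0 d) (sym (m*n%n≡0 0 d))

  -‿inverseˡ : ∀ a → - a + a ≈ 0
  -‿inverseˡ a = begin
    (- a + a) % d        ≡⟨ +-congˡ (- a) (%≈ a) ⟨
    (- a + a % d) % d    ≡⟨ cong (_% d) (m∸n+n≡m (m%n≤n a d)) ⟩
    d % d                ≡⟨ d≈0 ⟩
    0 % d                ∎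
    where open ≡-Reasoning

  +-isAbelianGroup : IsAbelianGroup _≈_ _+_ 0 -_
  +-isAbelianGroup = record
    { isGroup = record
      { isMonoid = record
        { isSemigroup = record
          { isMagma = record
            { isEquivalence = On.isEquivalence (_% d) isEquivalence
            ; ∙-cong        = +-cong
            }
          ; assoc = λ a b c → ≡⇒≈ (+-assoc a b c)
          }
        ; identity = (λ _ → refl) , (λ a → ≡⇒≈ (+-identityʳ a))
        }
      ; inverse = -‿inverseˡ , (λ a → trans (≡⇒≈ (+-comm a (- a))) (-‿inverseˡ a))
      ; ⁻¹-cong = -‿cong
      }
    ; comm = λ a b → ≡⇒≈ (+-comm a b)
    }

  +-abelianGroup : AbelianGroup 0ℓ 0ℓ
  +-abelianGroup = record { isAbelianGroup = +-isAbelianGroup }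

  ∸≈- : ∀ {m} → m < d → d ∸ m ≈ - m
  ∸≈- m<d = cong (λ x → (d ∸ x) % d) (sym (m<n⇒m%n≡m m<d))

  ≈⇒≡ : ∀ {a b} → a < d → b < d → a ≈ b → a ≡ b
  ≈⇒≡ a<d b<d a≈b = trans (sym (m<n⇒m%n≡m a<d)) (trans a≈b (m<n⇒m%n≡m b<d))

≈-mod-divisor : ∀ {e d} .{{_ : NonZero e}} .{{_ : NonZero d}} → e ∣ d →
                ∀ {a b} → Modular._≈_ d a b → Modular._≈_ e a b
≈-mod-divisor {e} {d} e∣d {a} {b} a≈b =
  trans (sym (m∣n⇒o%n%m≡o%m e d a e∣d)) (trans (cong (_% e) a≈b) (m∣n⇒o%n%m≡o%m e d b e∣d))

-‿mod-divisor : ∀ {e d} .{{_ : NonZero e}} .{{_ : NonZero d}} → e ∣ d →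
                ∀ a → Modular._≈_ e (Modular.-_ d a) (Modular.-_ e a)
-‿mod-divisor {e} {d} e∣d a =
  inverseˡ-unique (Modular.-_ d a) a (≈-mod-divisor e∣d (Modular.-‿inverseˡ d a))
  where open import Algebra.Properties.AbelianGroup (Modular.+-abelianGroup e) using (inverseˡ-unique)

module Action {a} {A : Set a} (n : ℕ) .{{_ : NonZero n}} where

  open Modular n
  open AbelianGroup +-abelianGroup using (setoid; assoc; identityʳ; inverseˡ)
  open import Algebra.Properties.AbelianGroup +-abelianGroup using (⁻¹-involutive; ⁻¹-anti-homo-∙; ⁻¹-∙-comm)

  pos-cong : ∀ {m m′} → m ≈ m′ → pos {n} m ≡ pos m′
  pos-cong {m} {m′} m≈m′ = fromℕ<-cong (m % n) (m′ % n) m≈m′ _ _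

  pos-toℕ : ∀ (i : Fin n) → pos (toℕ i) ≡ i
  pos-toℕ i = trans (fromℕ<-cong _ _ (m<n⇒m%n≡m (toℕ<n i)) _ (toℕ<n i)) (fromℕ<-toℕ i _)

  get : Vec A n → ℕ → A
  get v m = lookup v (pos m)

  get-cong : ∀ v {m m′} → m ≈ m′ → get v m ≡ get v m′
  get-cong v m≈m′ = cong (lookup v) (pos-cong m≈m′)

  get-ext : ∀ {v w} → (∀ {m} → m < n → get v m ≡ get w m) → v ≡ w
  get-ext {v} {w} v≗w = begin
    v                    ≡⟨ tabulate∘lookup v ⟨
    tabulate (lookup v)  ≡⟨ tabulate-cong (λ i → trans (cong (lookup v) (sym (pos-toℕ i)))
                                             (trans (v≗w (toℕ<n i)) (cong (lookup w) (pos-toℕ i)))) ⟩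
    tabulate (lookup w)  ≡⟨ tabulate∘lookup w ⟩
    w                    ∎
    where open ≡-Reasoning

  act : (ℕ → ℕ) → Vec A n → Vec A n
  act φ v = tabulate (λ i → get v (φ (toℕ i)))

  get-act : ∀ φ v m → get (act φ v) m ≡ get v (φ (m % n))
  get-act φ v m = trans (lookup∘tabulate _ (pos m)) (cong (get v ∘ φ) (toℕ-fromℕ< _))

  act-cong : ∀ {φ ψ} v → (∀ {m} → m < n → φ m ≈ ψ m) → act φ v ≡ act ψ v
  act-cong v φ≈ψ = tabulate-cong (λ i → get-cong v (φ≈ψ (toℕ<n i)))

  act-act : ∀ φ ψ v → act φ (act ψ v) ≡ act (λ m → ψ (φ m % n)) v
  act-act φ ψ v = tabulate-cong (λ i → get-act ψ v (φ (toℕ i)))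

  act-id : ∀ {φ} v → (∀ {m} → m < n → φ m ≈ m) → act φ v ≡ v
  act-id {φ} v φ≈id = get-ext (λ {m} m<n → trans (get-act φ v m)
    (get-cong v (trans (φ≈id (m%n<n m n)) (%≈ m))))

  -- In the notation of Defs, rot k = shift (- k), refl c = mirror (toℕ c) and flip = mirror 0,
  -- all definitionally.
  shift : ℕ → Vec A n → Vec A n
  shift a = act (_+ a)

  mirror : ℕ → Vec A n → Vec A n
  mirror c = act (λ m → c + (n ∸ m))

  shift-cong : ∀ {a b} v → a ≈ b → shift a v ≡ shift b v
  shift-cong v a≈b = act-cong v (λ {m} _ → +-congˡ m a≈b)

  mirror-cong : ∀ {c c′} v → c ≈ c′ → mirror c v ≡ mirror c′ v
  mirror-cong v c≈c′ = act-cong v (λ {m} _ → +-congʳ (n ∸ m) c≈c′)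

  shift-≈0 : ∀ {a} v → a ≈ 0 → shift a v ≡ v
  shift-≈0 v a≈0 = act-id v (λ {m} _ → trans (+-congˡ m a≈0) (identityʳ m))

  shift-shift : ∀ a b v → shift a (shift b v) ≡ shift (a + b) v
  shift-shift a b v = trans (act-act (_+ a) (_+ b) v) (act-cong v (λ {m} _ → begin
    (m + a) % n + b  ≈⟨ +-congʳ b (%≈ (m + a)) ⟩
    m + a + b        ≈⟨ assoc m a b ⟩
    m + (a + b)      ∎))
    where open import Relation.Binary.Reasoning.Setoid setoid

  shift-inverseˡ : ∀ a v → shift (- a) (shift a v) ≡ v
  shift-inverseˡ a v = trans (shift-shift (- a) a v) (shift-≈0 v (inverseˡ a))

  shift-injective : ∀ a {v w} → shift a v ≡ shift a w → v ≡ w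
  shift-injective a {v} {w} eq = begin
    v                        ≡⟨ shift-inverseˡ a v ⟨
    shift (- a) (shift a v)  ≡⟨ cong (shift (- a)) eq ⟩
    shift (- a) (shift a w)  ≡⟨ shift-inverseˡ a w ⟩
    w                        ∎
    where open ≡-Reasoning

  mirror-mirror : ∀ a b v → mirror a (mirror b v) ≡ shift (b + - a) v
  mirror-mirror a b v = trans (act-act (λ m → a + (n ∸ m)) (λ m → b + (n ∸ m)) v) (act-cong v (λ {m} m<n → begin
    b + - (a + (n ∸ m))  ≈⟨ +-congˡ b (-‿cong (+-congˡ a (∸≈- m<n))) ⟩
    b + - (a + - m)      ≈⟨ +-congˡ b (⁻¹-anti-homo-∙ a (- m)) ⟩
    b + (- - m + - a)    ≈⟨ +-congˡ b (+-congʳ (- a) (⁻¹-involutive m)) ⟩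
    b + (m + - a)        ≡⟨ x∙yz≈y∙xz b m (- a) ⟩
    m + (b + - a)        ∎))
    where open import Relation.Binary.Reasoning.Setoid setoid

  shift-mirror : ∀ a c v → shift a (mirror c v) ≡ mirror (c + - a) v
  shift-mirror a c v = trans (act-act (_+ a) (λ m → c + (n ∸ m)) v) (act-cong v (λ {m} m<n → begin
    c + - (m + a)        ≈⟨ +-congˡ c (⁻¹-∙-comm m a) ⟨
    c + (- m + - a)      ≡⟨ x∙yz≈xz∙y c (- m) (- a) ⟩
    c + - a + - m        ≈⟨ +-congˡ (c + - a) (∸≈- m<n) ⟨
    c + - a + (n ∸ m)    ∎))
    where open import Relation.Binary.Reasoning.Setoid setoid

  mirror-shift : ∀ c a v → mirror c (shift a v) ≡ mirror (c + a) v
  mirror-shift c a v = trans (act-act (λ m → c + (n ∸ m)) (_+ a) v) (act-cong v (λ {m} _ → begin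
    (c + (n ∸ m)) % n + a  ≈⟨ +-congʳ a (%≈ (c + (n ∸ m))) ⟩
    c + (n ∸ m) + a        ≡⟨ xy∙z≈xz∙y c (n ∸ m) a ⟩
    c + a + (n ∸ m)        ∎))
    where open import Relation.Binary.Reasoning.Setoid setoid

tabulate-∷ʳ : ∀ {a} {A : Set a} {m} (f : Fin (suc m) → A) →
              tabulate f ≡ tabulate (f ∘ inject₁) ∷ʳ f (fromℕ m)
tabulate-∷ʳ {m = zero}  f = refl
tabulate-∷ʳ {m = suc m} f = cong (f fzero ∷_) (tabulate-∷ʳ (f ∘ fsuc))

shift-one : ∀ {a} {A : Set a} {m} (x : A) (w : Vec A m) → Action.shift (suc m) 1 (x ∷ w) ≡ w ∷ʳ x
shift-one {m = m} x w = begin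
  tabulate f                              ≡⟨ tabulate-∷ʳ f ⟩
  tabulate (f ∘ inject₁) ∷ʳ f (fromℕ m)   ≡⟨ cong₂ _∷ʳ_ (tabulate-cong f-inject₁) f-last ⟩
  tabulate (lookup w) ∷ʳ x                ≡⟨ cong (_∷ʳ x) (tabulate∘lookup w) ⟩
  w ∷ʳ x                                  ∎
  where
  open ≡-Reasoning
  f = λ i → Action.get (suc m) (x ∷ w) (toℕ i + 1)
  inner : ∀ i → (toℕ (inject₁ i) + 1) % suc m ≡ toℕ (fsuc i)
  inner i = begin
    (toℕ (inject₁ i) + 1) % suc m  ≡⟨ cong (λ k → (k + 1) % suc m) (toℕ-inject₁ i) ⟩
    (toℕ i + 1) % suc m            ≡⟨ cong (_% suc m) (+-comm (toℕ i) 1) ⟩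
    suc (toℕ i) % suc m            ≡⟨ m<n⇒m%n≡m (toℕ<n (fsuc i)) ⟩
    suc (toℕ i)                    ∎
  last : (toℕ (fromℕ m) + 1) % suc m ≡ 0
  last = begin
    (toℕ (fromℕ m) + 1) % suc m    ≡⟨ cong (λ k → (k + 1) % suc m) (toℕ-fromℕ m) ⟩
    (m + 1) % suc m                ≡⟨ cong (_% suc m) (+-comm m 1) ⟩
    suc m % suc m                  ≡⟨ n%n≡0 (suc m) ⟩
    0                              ∎
  f-inject₁ : ∀ i → f (inject₁ i) ≡ lookup w i
  f-inject₁ i = cong (lookup (x ∷ w)) (toℕ-injective (trans (toℕ-fromℕ< _) (inner i)))
  f-last : f (fromℕ m) ≡ x
  f-last = cong (lookup (x ∷ w)) (toℕ-injective (trans (toℕ-fromℕ< _) last))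

module _ {a} {A : Set a} where

  lookup-∷ʳ-inject₁ : ∀ {n} (xs : Vec A n) x i → lookup (xs ∷ʳ x) (inject₁ i) ≡ lookup xs i
  lookup-∷ʳ-inject₁ (y ∷ xs) x fzero    = refl
  lookup-∷ʳ-inject₁ (y ∷ xs) x (fsuc i) = lookup-∷ʳ-inject₁ xs x i

  lookup-∷ʳ-fromℕ : ∀ {n} (xs : Vec A n) x → lookup (xs ∷ʳ x) (fromℕ n) ≡ x
  lookup-∷ʳ-fromℕ []       x = refl
  lookup-∷ʳ-fromℕ (y ∷ xs) x = lookup-∷ʳ-fromℕ xs x

  lookup-reverse-opposite : ∀ {n} (xs : Vec A n) i → lookup (reverse xs) (opposite i) ≡ lookup xs i
  lookup-reverse-opposite (x ∷ xs) fzero = begin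
    lookup (reverse (x ∷ xs)) (fromℕ _)   ≡⟨ cong (λ ys → lookup ys (fromℕ _)) (reverse-∷ x xs) ⟩
    lookup (reverse xs ∷ʳ x) (fromℕ _)    ≡⟨ lookup-∷ʳ-fromℕ (reverse xs) x ⟩
    x                                     ∎
    where open ≡-Reasoning
  lookup-reverse-opposite (x ∷ xs) (fsuc i) = begin
    lookup (reverse (x ∷ xs)) (inject₁ (opposite i))  ≡⟨ cong (λ ys → lookup ys (inject₁ (opposite i))) (reverse-∷ x xs) ⟩
    lookup (reverse xs ∷ʳ x) (inject₁ (opposite i))   ≡⟨ lookup-∷ʳ-inject₁ (reverse xs) x (opposite i) ⟩
    lookup (reverse xs) (opposite i)                  ≡⟨ lookup-reverse-opposite xs i ⟩
    lookup xs i                                       ∎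
    where open ≡-Reasoning

  reverse≡tabulate : ∀ {n} (xs : Vec A n) → reverse xs ≡ tabulate (lookup xs ∘ opposite)
  reverse≡tabulate xs = trans (sym (tabulate∘lookup (reverse xs))) (tabulate-cong (λ i →
    trans (cong (lookup (reverse xs)) (sym (opposite-involutive i))) (lookup-reverse-opposite xs (opposite i))))

  reverse-++-∷ : ∀ {n} (w w′ : Vec A n) b → reverse (w ++ (b ∷ w′)) ≡ reverse w′ ++ (b ∷ reverse w)
  reverse-++-∷ w w′ b = trans (sym (cast-is-id refl _)) (toList-injective refl _ _ (begin
    toList (reverse (w ++ (b ∷ w′)))
      ≡⟨ toList-reverse (w ++ (b ∷ w′)) ⟩
    List.reverse (toList (w ++ (b ∷ w′)))
      ≡⟨ cong List.reverse (toList-++ w (b ∷ w′)) ⟩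
    List.reverse (toList w List.++ b ∷ toList w′)
      ≡⟨ List.reverse-++ (toList w) (b ∷ toList w′) ⟩
    List.reverse (b ∷ toList w′) List.++ List.reverse (toList w)
      ≡⟨ cong (List._++ List.reverse (toList w)) (List.unfold-reverse b (toList w′)) ⟩
    (List.reverse (toList w′) List.++ List.[ b ]) List.++ List.reverse (toList w)
      ≡⟨ List.++-assoc (List.reverse (toList w′)) List.[ b ] _ ⟩
    List.reverse (toList w′) List.++ b ∷ List.reverse (toList w)
      ≡⟨ cong₂ (λ xs ys → xs List.++ b ∷ ys) (toList-reverse w′) (toList-reverse w) ⟨
    toList (reverse w′) List.++ toList (b ∷ reverse w)
      ≡⟨ toList-++ (reverse w′) (b ∷ reverse w) ⟨
    toList (reverse w′ ++ (b ∷ reverse w))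
      ∎))
    where open ≡-Reasoning

  mirror-0-∷ : ∀ {L} (x : A) (u : Vec A L) → Action.mirror (suc L) 0 (x ∷ u) ≡ x ∷ reverse u
  mirror-0-∷ {L} x u = cong₂ _∷_ (cong (lookup (x ∷ u)) (toℕ-injective head))
    (trans (tabulate-cong (λ i → cong (lookup (x ∷ u)) (toℕ-injective (tail i)))) (sym (reverse≡tabulate u)))
    where
    head : toℕ (pos {suc L} (suc L)) ≡ 0
    head = trans (toℕ-fromℕ< _) (n%n≡0 (suc L))
    tail : ∀ i → toℕ (pos {suc L} (L ∸ toℕ i)) ≡ toℕ (fsuc (opposite i))
    tail i = begin
      toℕ (pos {suc L} (L ∸ toℕ i))  ≡⟨ toℕ-fromℕ< _ ⟩
      (L ∸ toℕ i) % suc L            ≡⟨ m≤n⇒m%n≡m (m∸n≤m L (toℕ i)) ⟩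
      L ∸ toℕ i                      ≡⟨ +-∸-assoc 1 (toℕ<n i) ⟩
      suc (L ∸ suc (toℕ i))          ≡⟨ cong suc (opposite-prop i) ⟨
      suc (toℕ (opposite i))         ∎
      where open ≡-Reasoning

blue-∷ : ∀ {m} b (v : Coloring m) → blue (b ∷ v) ≡ blue (b ∷ []) + blue v
blue-∷ true  v = refl
blue-∷ false v = refl

blue-++ : ∀ {m k} (v : Coloring m) (w : Coloring k) → blue (v ++ w) ≡ blue v + blue w
blue-++ []          w = refl
blue-++ (true ∷ v)  w = cong suc (blue-++ v w)
blue-++ (false ∷ v) w = blue-++ v w

blue-∷ʳ : ∀ {m} (w : Coloring m) b → blue (w ∷ʳ b) ≡ blue (b ∷ w)
blue-∷ʳ []      b = refl
blue-∷ʳ (c ∷ w) b = begin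
  blue (c ∷ (w ∷ʳ b))      ≡⟨ blue-∷ c (w ∷ʳ b) ⟩
  [c] + blue (w ∷ʳ b)      ≡⟨ cong ([c] +_) (trans (blue-∷ʳ w b) (blue-∷ b w)) ⟩
  [c] + ([b] + blue w)     ≡⟨ x∙yz≈y∙xz [c] [b] (blue w) ⟩
  [b] + ([c] + blue w)     ≡⟨ cong ([b] +_) (blue-∷ c w) ⟨
  [b] + blue (c ∷ w)       ≡⟨ blue-∷ b (c ∷ w) ⟨
  blue (b ∷ c ∷ w)         ∎
  where
  open ≡-Reasoning
  [b] = blue (b ∷ [])
  [c] = blue (c ∷ [])

blue-reverse : ∀ {m} (v : Coloring m) → blue (reverse v) ≡ blue v
blue-reverse []      = refl
blue-reverse (b ∷ v) = begin
  blue (reverse (b ∷ v))            ≡⟨ cong blue (reverse-∷ b v) ⟩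
  blue (reverse v ∷ʳ b)             ≡⟨ blue-∷ʳ (reverse v) b ⟩
  blue (b ∷ reverse v)              ≡⟨ blue-∷ b (reverse v) ⟩
  blue (b ∷ []) + blue (reverse v)  ≡⟨ cong (blue (b ∷ []) +_) (blue-reverse v) ⟩
  blue (b ∷ []) + blue v            ≡⟨ blue-∷ b v ⟨
  blue (b ∷ v)                      ∎
  where open ≡-Reasoning

blue-∷-++-∷-reverse : ∀ {h} a b (w : Coloring h) →
                      blue (a ∷ (w ++ (b ∷ reverse w))) ≡ (blue (a ∷ []) + blue (b ∷ [])) + (blue w + blue w)
blue-∷-++-∷-reverse a b w = begin
  blue (a ∷ (w ++ (b ∷ reverse w)))                  ≡⟨ blue-∷ a (w ++ (b ∷ reverse w)) ⟩
  [a] + blue (w ++ (b ∷ reverse w))                  ≡⟨ cong ([a] +_) (blue-++ w (b ∷ reverse w)) ⟩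
  [a] + (blue w + blue (b ∷ reverse w))              ≡⟨ cong (λ k → [a] + (blue w + k)) (blue-∷ b (reverse w)) ⟩
  [a] + (blue w + ([b] + blue (reverse w)))          ≡⟨ cong (λ k → [a] + (blue w + ([b] + k))) (blue-reverse w) ⟩
  [a] + (blue w + ([b] + blue w))                    ≡⟨ cong ([a] +_) (x∙yz≈y∙xz (blue w) [b] (blue w)) ⟩
  [a] + ([b] + (blue w + blue w))                    ≡⟨ +-assoc [a] [b] _ ⟨
  ([a] + [b]) + (blue w + blue w)                    ∎
  where
  open ≡-Reasoning
  [a] = blue (a ∷ [])
  [b] = blue (b ∷ [])

blue-shift-one : ∀ {n} .{{_ : NonZero n}} (v : Coloring n) → blue (Action.shift n 1 v) ≡ blue v
blue-shift-one (x ∷ w) = trans (cong blue (shift-one x w)) (blue-∷ʳ w x)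

blue-shift : ∀ {n} .{{_ : NonZero n}} a (v : Coloring n) → blue (Action.shift n a v) ≡ blue v
blue-shift {n} zero    v = cong blue (Action.shift-≈0 n v refl)
blue-shift {n} (suc a) v = begin
  blue (Action.shift n (1 + a) v)                  ≡⟨ cong blue (Action.shift-shift n 1 a v) ⟨
  blue (Action.shift n 1 (Action.shift n a v))     ≡⟨ blue-shift-one (Action.shift n a v) ⟩
  blue (Action.shift n a v)                        ≡⟨ blue-shift a v ⟩
  blue v                                           ∎
  where open ≡-Reasoning

∈-allColorings : ∀ {n} (v : Coloring n) → v ∈ allColorings n
∈-allColorings []                = here refl
∈-allColorings {suc n} (true ∷ v)  = ∈-++⁺ˡ (∈-map⁺ (true ∷_) (∈-allColorings v))
∈-allColorings {suc n} (false ∷ v) =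
  ∈-++⁺ʳ (map (true ∷_) (allColorings n)) (∈-map⁺ (false ∷_) (∈-allColorings v))

allColorings-unique : ∀ n → Unique (allColorings n)
allColorings-unique zero    = All.[] AllPairs.∷ AllPairs.[]
allColorings-unique (suc n) = Unique.++⁺ (Unique.map⁺ ∷-injectiveʳ (allColorings-unique n))
                                         (Unique.map⁺ ∷-injectiveʳ (allColorings-unique n)) disjoint
  where
  disjoint : ∀ {v} → ¬ (v ∈ map (true ∷_) (allColorings n) × v ∈ map (false ∷_) (allColorings n))
  disjoint (v∈ , v∈′) with ∈-map⁻ (true ∷_) v∈ | ∈-map⁻ (false ∷_) v∈′
  ... | _ , _ , refl | _ , _ , ()

Neck-unique : ∀ n j → Unique (Neck n j)
Neck-unique n j = Unique.filter⁺ (λ v → blue v ≟ j) (allColorings-unique n)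

∈-Neck⁺ : ∀ {n j} {v : Coloring n} → blue v ≡ j → v ∈ Neck n j
∈-Neck⁺ {j = j} {v} blue≡j = ∈-filter⁺ (λ v → blue v ≟ j) (∈-allColorings v) blue≡j

∈-Neck⁻ : ∀ {n j} {v : Coloring n} → v ∈ Neck n j → blue v ≡ j
∈-Neck⁻ {n} {j} v∈ = proj₂ (∈-filter⁻ (λ v → blue v ≟ j) {xs = allColorings n} v∈)

length-Neck : ∀ n j → length (Neck n j) ≡ n C j
length-Neck zero    zero    = refl
length-Neck zero    (suc j) = refl
length-Neck (suc n) j = begin
  length (filter P? (map (true ∷_) cs List.++ map (false ∷_) cs))
    ≡⟨ cong length (filter-++ P? (map (true ∷_) cs) _) ⟩
  length (filter P? (map (true ∷_) cs) List.++ filter P? (map (false ∷_) cs))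
    ≡⟨ length-++ (filter P? (map (true ∷_) cs)) ⟩
  length (filter P? (map (true ∷_) cs)) + length (filter P? (map (false ∷_) cs))
    ≡⟨ cong₂ _+_ (length-filter-map P? (true ∷_) cs) (length-filter-map P? (false ∷_) cs) ⟩
  length (filter (λ v → suc (blue v) ≟ j) cs) + length (Neck n j)
    ≡⟨ split j ⟩
  suc n C j
    ∎
  where
  open ≡-Reasoning
  cs = allColorings n
  P? : (v : Coloring (suc n)) → Dec (blue v ≡ j)
  P? v = blue v ≟ j
  split : ∀ j → length (filter (λ v → suc (blue v) ≟ j) cs) + length (Neck n j) ≡ suc n C j
  split zero    = trans (cong (λ vs → length vs + length (Neck n 0)) no-blue) (length-Neck n 0)
    where
    no-blue : filter (λ v → suc (blue v) ≟ 0) cs ≡ []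
    no-blue = filter-none (λ v → suc (blue v) ≟ 0) (All.universal (λ _ ()) cs)
  split (suc j) = begin
    length (filter (λ v → suc (blue v) ≟ suc j) cs) + length (Neck n (suc j))
      ≡⟨ cong (λ vs → length vs + length (Neck n (suc j)))
              (filter-≐ (λ v → suc (blue v) ≟ suc j) (λ v → blue v ≟ j) (suc-injective , cong suc) cs) ⟩
    length (Neck n j) + length (Neck n (suc j))
      ≡⟨ cong₂ _+_ (length-Neck n j) (length-Neck n (suc j)) ⟩
    n C j + n C suc j
      ≡⟨ nCk+nC[k+1]≡[n+1]C[k+1] n j ⟩
    suc n C suc j
      ∎

module Orbit (n : ℕ) .{{_ : NonZero n}} where

  open Modular n
  open Action {A = Bool} n
  open AbelianGroup +-abelianGroup using (setoid; inverseˡ; inverseʳ; identityʳ; assoc) renaming (sym to ≈-sym)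
  open import Algebra.Properties.AbelianGroup +-abelianGroup using (⁻¹-involutive; ε⁻¹≈ε)
  open import Data.List.Relation.Unary.Unique.DecPropositional.Properties (_≟C_ {n}) using (deduplicate-!)

  toℕ-pos : ∀ m → toℕ (pos {n} m) ≈ m
  toℕ-pos m = trans (cong (_% n) (toℕ-fromℕ< _)) (%≈ m)

  record Shifted (v w : Coloring n) : Set where
    constructor _,_
    field
      amount  : ℕ
      shifts  : shift amount v ≡ w

  shifted-refl : ∀ {v} → Shifted v v
  shifted-refl {v} = 0 , shift-≈0 v refl

  shifted-sym : ∀ {v w} → Shifted v w → Shifted w v
  shifted-sym {v} (a , refl) = - a , shift-inverseˡ a v

  shifted-trans : ∀ {u v w} → Shifted u v → Shifted v w → Shifted u w
  shifted-trans {u} (a , refl) (b , refl) = b + a , sym (shift-shift b a u)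

  sameOrbit⇒shifted : ∀ {v w} → SameOrbit v w → Shifted v w
  sameOrbit⇒shifted (k , eq) = - toℕ k , eq

  shifted⇒sameOrbit : ∀ {v w} → Shifted v w → SameOrbit v w
  shifted⇒sameOrbit {v} (a , eq) = pos (- a) , trans (shift-cong v (neg-pos-neg a)) eq
    where
    neg-pos-neg : ∀ a → - toℕ (pos {n} (- a)) ≈ a
    neg-pos-neg a = trans (-‿cong (toℕ-pos (- a))) (⁻¹-involutive a)

  sameOrbit-decSetoid : DecSetoid 0ℓ 0ℓ
  sameOrbit-decSetoid = record
    { Carrier = Coloring n
    ; _≈_ = SameOrbit
    ; isDecEquivalence = record
      { isEquivalence = record
        { refl  = λ {v} → shifted⇒sameOrbit {v} shifted-refl
        ; sym   = λ {v} {w} p → shifted⇒sameOrbit {w} (shifted-sym (sameOrbit⇒shifted {v} p))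
        ; trans = λ {u} {v} p q →
            shifted⇒sameOrbit {u} (shifted-trans (sameOrbit⇒shifted {u} p) (sameOrbit⇒shifted {v} q))
        }
      ; _≟_ = sameOrbit?
      }
    }

  mirror-fixes-shift : ∀ {c} a {v} → mirror c v ≡ v → mirror (c + - a + - a) (shift a v) ≡ shift a v
  mirror-fixes-shift {c} a {v} fixed = begin
    mirror (c + - a + - a) (shift a v)    ≡⟨ mirror-shift (c + - a + - a) a v ⟩
    mirror (c + - a + - a + a) v          ≡⟨ mirror-cong v (x-a+a≈x (c + - a)) ⟩
    mirror (c + - a) v                    ≡⟨ shift-mirror a c v ⟨
    shift a (mirror c v)                  ≡⟨ cong (shift a) fixed ⟩
    shift a v                             ∎
    where
    open ≡-Reasoning
    x-a+a≈x : ∀ x → x + - a + a ≈ x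
    x-a+a≈x x = trans (assoc x (- a) a) (trans (+-congˡ x (inverseˡ a)) (identityʳ x))

  flipFixed? : (v : Coloring n) → Dec (flip v ≡ v)
  flipFixed? v = flip v ≟C v

  HasAxis : Coloring n → Set
  HasAxis v = ∃ λ c → mirror c v ≡ v

  hasAxis-respects : HasAxis Respects Shifted
  hasAxis-respects (a , refl) (c , fixed) = c + - a + - a , mirror-fixes-shift a fixed

  fFixed⇒hasAxis : ∀ {v} → FFixed v → HasAxis v
  fFixed⇒hasAxis {v} ff with sameOrbit⇒shifted {v} ff
  ... | a , shifted = - - a , (begin
    mirror (- - a) v              ≡⟨ shift-mirror (- a) 0 v ⟨
    shift (- a) (mirror 0 v)      ≡⟨ cong (shift (- a)) shifted ⟨
    shift (- a) (shift a v)       ≡⟨ shift-inverseˡ a v ⟩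
    v                             ∎)
    where open ≡-Reasoning

  hasAxis⇒fFixed : ∀ {v} → HasAxis v → FFixed v
  hasAxis⇒fFixed {v} (c , fixed) = shifted⇒sameOrbit {v} (c + - 0 , (begin
    shift (c + - 0) v          ≡⟨ mirror-mirror 0 c v ⟨
    mirror 0 (mirror c v)      ≡⟨ cong (mirror 0) fixed ⟩
    mirror 0 v                 ∎))
    where open ≡-Reasoning

  -- The axis of mirror (h + h) passes through P_h: these are the type 2 axes.
  HasEvenAxis : Coloring n → Set
  HasEvenAxis v = ∃ λ h → mirror (h + h) v ≡ v

  hasEvenAxis-respects : HasEvenAxis Respects Shifted
  hasEvenAxis-respects {v} (a , refl) (h , fixed) =
    h + - a , subst (λ c → mirror c (shift a v) ≡ shift a v) (double-+ h (- a)) (mirror-fixes-shift a fixed)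
    where
    double-+ : ∀ h x → h + h + x + x ≡ (h + x) + (h + x)
    double-+ h x = trans (+-assoc (h + h) x x) (interchange h h x x)

  axisContains⇒≈double : ∀ {c m : Fin n} → AxisContains c m → toℕ c ≈ toℕ m + toℕ m
  axisContains⇒≈double {c} {m} contains = begin
    toℕ c                              ≈⟨ identityʳ (toℕ c) ⟨
    toℕ c + 0                          ≈⟨ +-congˡ (toℕ c) (inverseˡ (toℕ m)) ⟨
    toℕ c + (- toℕ m + toℕ m)          ≈⟨ assoc (toℕ c) (- toℕ m) (toℕ m) ⟨
    toℕ c + - toℕ m + toℕ m            ≈⟨ +-congʳ (toℕ m) (+-congˡ (toℕ c) (∸≈- (toℕ<n m))) ⟨
    toℕ c + (n ∸ toℕ m) + toℕ m        ≈⟨ +-congʳ (toℕ m) reflected ⟩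
    toℕ m + toℕ m                      ∎
    where
    open import Relation.Binary.Reasoning.Setoid setoid
    reflected : toℕ c + (n ∸ toℕ m) ≈ toℕ m
    reflected = trans (sym (toℕ-fromℕ< _)) (trans (cong toℕ contains) (sym (m<n⇒m%n≡m (toℕ<n m))))

  hasType2Rep⇒hasEvenAxis : ∀ {v} → HasType2Rep v → HasEvenAxis v
  hasType2Rep⇒hasEvenAxis {v} (k , c , symmetric , m , contains) =
    hasEvenAxis-respects (shifted-sym (- toℕ k , refl))
      (toℕ m , trans (mirror-cong (rot (toℕ k) v) (≈-sym (axisContains⇒≈double contains))) symmetric)

  hasEvenAxis⇒hasType2Rep : ∀ {v} → HasEvenAxis v → HasType2Rep v
  hasEvenAxis⇒hasType2Rep {v} (h , fixed) =
    pos 0 , subst HasType2Axis (sym rot-pos-0) (pos (h + h) , isAxis , pos h , pos-cong contains)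
    where
    rot-pos-0 : rot (toℕ (pos {n} 0)) v ≡ v
    rot-pos-0 = shift-≈0 v (trans (-‿cong (toℕ-pos 0)) ε⁻¹≈ε)
    isAxis : mirror (toℕ (pos {n} (h + h))) v ≡ v
    isAxis = trans (mirror-cong v (toℕ-pos (h + h))) fixed
    contains : toℕ (pos {n} (h + h)) + (n ∸ toℕ (pos {n} h)) ≈ h
    contains = begin
      toℕ (pos (h + h)) + (n ∸ toℕ (pos h))  ≈⟨ +-cong (toℕ-pos (h + h)) (≡⇒≈ (cong (n ∸_) (toℕ-fromℕ< (m%n<n h n)))) ⟩
      h + h + - h                            ≈⟨ assoc h h (- h) ⟩
      h + (h + - h)                          ≈⟨ +-congˡ h (inverseʳ h) ⟩
      h + 0                                  ≈⟨ identityʳ h ⟩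
      h                                      ∎
      where open import Relation.Binary.Reasoning.Setoid setoid

  rotations : Coloring n → List (Coloring n)
  rotations v = deduplicate _≟C_ (map (λ k → rot (toℕ k) v) (allFin n))

  ∈-rotations⁻ : ∀ {v x} → x ∈ rotations v → Shifted v x
  ∈-rotations⁻ {v} x∈ with ∈-map⁻ (λ k → rot (toℕ k) v) (∈-deduplicate⁻ _≟C_ _ x∈)
  ... | k , _ , refl = - toℕ k , refl

  ∈-rotations⁺ : ∀ {v x} → Shifted v x → x ∈ rotations v
  ∈-rotations⁺ {v} v∼x with shifted⇒sameOrbit {v} v∼x
  ... | k , refl = ∈-deduplicate⁺ _≟C_ (∈-map⁺ (λ k → rot (toℕ k) v) (∈-allFin k))

  orbitCard-cong : ∀ {v w} → Shifted v w → orbitCard v ≡ orbitCard w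
  orbitCard-cong {v} {w} v∼w = unique∧set⇒length≡ (deduplicate-! _) (deduplicate-! _)
    (λ x∈ → ∈-rotations⁺ (shifted-trans (shifted-sym v∼w) (∈-rotations⁻ x∈)))
    (λ x∈ → ∈-rotations⁺ (shifted-trans v∼w (∈-rotations⁻ x∈)))

Even : ℕ → Set
Even m = ∃ λ h → m ≡ h + h

Odd : ℕ → Set
Odd m = ∃ λ h → m ≡ suc (h + h)

even-or-odd : ∀ m → Even m ⊎ Odd m
even-or-odd zero    = inj₁ (0 , refl)
even-or-odd (suc m) with even-or-odd m
... | inj₁ (h , refl) = inj₂ (h , refl)
... | inj₂ (h , refl) = inj₁ (suc h , cong suc (sym (+-suc h h)))

double≡2* : ∀ h → h + h ≡ 2 * h
double≡2* h = cong (h +_) (sym (+-identityʳ h))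

double/2 : ∀ h → (h + h) / 2 ≡ h
double/2 h = trans (cong (_/ 2) (trans (double≡2* h) (*-comm 2 h))) (m*n/n≡m h 2)

even⇒2∣ : ∀ {m} → Even m → 2 ∣ m
even⇒2∣ (h , refl) = divides h (trans (double≡2* h) (*-comm 2 h))

2∣⇒even : ∀ {m} → 2 ∣ m → Even m
2∣⇒even (divides q refl) = q , trans (*-comm q 2) (sym (double≡2* q))

even⇒¬odd : ∀ {m} → Even m → ¬ Odd m
even⇒¬odd (h , refl) (k , eq) = even≢odd h k (trans (sym (double≡2* h)) (trans eq (cong suc (double≡2* k))))

double-injective : ∀ {a b} → a + a ≡ b + b → a ≡ b
double-injective {a} {b} eq = *-cancelˡ-≡ a b 2 (trans (sym (double≡2* a)) (trans eq (double≡2* b)))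

double-cancel-< : ∀ {a b} → a + a < b + b → a < b
double-cancel-< {a} {b} lt = *-cancelˡ-< 2 a b (subst₂ _<_ (double≡2* a) (double≡2* b) lt)

odd+odd : ∀ {x y} → Odd x → Odd y → Even (x + y)
odd+odd (h , refl) (k , refl) = suc (h + k) , cong suc (begin
  h + h + suc (k + k)      ≡⟨ +-suc (h + h) (k + k) ⟩
  suc (h + h + (k + k))    ≡⟨ cong suc (interchange h h k k) ⟩
  suc (h + k + (h + k))    ≡⟨ +-suc (h + k) (h + k) ⟨
  h + k + suc (h + k)      ∎)
  where open ≡-Reasoning

odd+even : ∀ {x y} → Odd x → Even y → Odd (x + y)
odd+even (h , refl) (k , refl) = h + k , cong suc (interchange h h k k)

even-cancelʳ : ∀ {x y} → Even (x + y) → Even y → Even x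
even-cancelʳ {x} x+y-even y-even with even-or-odd x
... | inj₁ x-even = x-even
... | inj₂ x-odd  = contradiction (odd+even x-odd y-even) (even⇒¬odd x+y-even)

module Halves (d : ℕ) .{{_ : NonZero d}} where

  below-twice : ∀ {t} → t < d + d → t ≡ t % d ⊎ t ≡ t % d + d
  below-twice {t} t<2d with t <? d
  ... | yes t<d = inj₁ (sym (m<n⇒m%n≡m t<d))
  ... | no t≮d  = inj₂ (begin
    t              ≡⟨ m∸n+n≡m d≤t ⟨
    t ∸ d + d      ≡⟨ cong (_+ d) (m<n⇒m%n≡m t∸d<d) ⟨
    (t ∸ d) % d + d ≡⟨ cong (_+ d) (m≤n⇒[n∸m]%m≡n%m d≤t) ⟩
    t % d + d      ∎)
    where
    open ≡-Reasoning
    d≤t : d ≤ t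
    d≤t = ≮⇒≥ t≮d
    t∸d<d : t ∸ d < d
    t∸d<d = +-cancelʳ-< d (t ∸ d) d (subst (_< d + d) (sym (m∸n+n≡m d≤t)) t<2d)

  double-below-twice : ∀ {a} → a < d → a + a ≡ (a + a) % d ⊎ a + a ≡ (a + a) % d + d
  double-below-twice a<d = below-twice (+-mono-< a<d a<d)

  even-gap : ∀ {a b x} → a + a ≡ x → b + b ≡ x + d → Even d
  even-gap {a} {b} {x} a+a b+b = even-cancelʳ (b , (begin
    d + (a + a)    ≡⟨ +-comm d (a + a) ⟩
    a + a + d      ≡⟨ cong (_+ d) a+a ⟩
    x + d          ≡⟨ b+b ⟨
    b + b          ∎)) (a , refl)
    where open ≡-Reasoning

  halves : ℕ → List ℕ
  halves c = filter (λ a → (a + a) % d ≟ c) (upTo d)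

  ∈-halves⁺ : ∀ {a c} → a < d → (a + a) % d ≡ c → a ∈ halves c
  ∈-halves⁺ a<d half = ∈-filter⁺ (λ a → (a + a) % d ≟ _) (∈-upTo⁺ a<d) half

  ∈-halves⁻ : ∀ {a c} → a ∈ halves c → a < d × (a + a) % d ≡ c
  ∈-halves⁻ {c = c} a∈ with ∈-filter⁻ (λ a → (a + a) % d ≟ c) {xs = upTo d} a∈
  ... | a∈upTo , half = ∈-upTo⁻ a∈upTo , half

  halves-unique : ∀ c → Unique (halves c)
  halves-unique c = Unique.filter⁺ (λ a → (a + a) % d ≟ c) (Unique.upTo⁺ d)

  module _ (d-odd : Odd d) where

    halves-injective : ∀ {a b} → a < d → b < d → (a + a) % d ≡ (b + b) % d → a ≡ b
    halves-injective {a} {b} a<d b<d eq with double-below-twice a<d | double-below-twice b<d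
    ... | inj₁ a+a | inj₁ b+b = double-injective (trans a+a (trans eq (sym b+b)))
    ... | inj₂ a+a | inj₂ b+b = double-injective (trans a+a (trans (cong (_+ d) eq) (sym b+b)))
    ... | inj₁ a+a | inj₂ b+b = contradiction d-odd (even⇒¬odd (even-gap {a} {b} (trans a+a eq) b+b))
    ... | inj₂ a+a | inj₁ b+b = contradiction d-odd (even⇒¬odd (even-gap {b} {a} (trans b+b (sym eq)) a+a))

    half-exists : ∀ {c} → c < d → ∃ λ a → a < d × (a + a) % d ≡ c
    half-exists {c} c<d with even-or-odd c
    ... | inj₁ (h , refl) = h , ≤-<-trans (m≤m+n h h) c<d , m<n⇒m%n≡m c<d
    ... | inj₂ c-odd with odd+odd c-odd d-odd
    ...   | a , c+d≡a+a = a , double-cancel-< (subst (_< d + d) c+d≡a+a (+-monoˡ-< d c<d)) , (begin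
      (a + a) % d    ≡⟨ cong (_% d) c+d≡a+a ⟨
      (c + d) % d    ≡⟨ [m+n]%n≡m%n c d ⟩
      c % d          ≡⟨ m<n⇒m%n≡m c<d ⟩
      c              ∎)
      where open ≡-Reasoning

    length-halves-odd : ∀ {c} → c < d → length (halves c) ≡ 1
    length-halves-odd {c} c<d with half-exists c<d
    ... | a , a<d , half = unique∧set⇒length≡ (halves-unique c) (All.[] AllPairs.∷ AllPairs.[])
      (λ b∈ → let b<d , half′ = ∈-halves⁻ b∈ in here (halves-injective b<d a<d (trans half′ (sym half))))
      (λ { (here refl) → ∈-halves⁺ a<d half })

  module _ {k} (d≡k+k : d ≡ k + k) where

    halves-even : ∀ {h a} → a < d → (a + a) % d ≡ h + h → a ≡ h ⊎ a ≡ h + k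
    halves-even {h} {a} a<d half with double-below-twice a<d
    ... | inj₁ a+a = inj₁ (double-injective (trans a+a half))
    ... | inj₂ a+a = inj₂ (double-injective (begin
      a + a                ≡⟨ a+a ⟩
      (a + a) % d + d      ≡⟨ cong₂ _+_ half d≡k+k ⟩
      (h + h) + (k + k)    ≡⟨ interchange h h k k ⟩
      (h + k) + (h + k)    ∎))
      where open ≡-Reasoning

    length-halves-even : ∀ {h} → h + h < d → length (halves (h + h)) ≡ 2
    length-halves-even {h} c<d = unique∧set⇒length≡ (halves-unique (h + h)) h∷h+k-unique to from
      where
      h<k : h < k
      h<k = double-cancel-< (subst (h + h <_) d≡k+k c<d)
      h<d : h < d
      h<d = ≤-<-trans (m≤m+n h h) c<d
      h+k<d : h + k < d
      h+k<d = subst (h + k <_) (sym d≡k+k) (+-monoˡ-< k h<k)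
      h+k-half : ((h + k) + (h + k)) % d ≡ h + h
      h+k-half = begin
        ((h + k) + (h + k)) % d   ≡⟨ cong (_% d) (interchange h k h k) ⟩
        ((h + h) + (k + k)) % d   ≡⟨ cong (λ e → (h + h + e) % d) d≡k+k ⟨
        ((h + h) + d) % d         ≡⟨ [m+n]%n≡m%n (h + h) d ⟩
        (h + h) % d               ≡⟨ m<n⇒m%n≡m c<d ⟩
        h + h                     ∎
        where open ≡-Reasoning
      h∷h+k-unique : Unique (h ∷ h + k ∷ [])
      h∷h+k-unique = (h≢h+k All.∷ All.[]) AllPairs.∷ (All.[] AllPairs.∷ AllPairs.[])
        where
        h≢h+k : h ≢ h + k
        h≢h+k eq = m<n⇒n≢0 h<k (+-cancelˡ-≡ h k 0 (trans (sym eq) (sym (+-identityʳ h))))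
      to : ∀ {a} → a ∈ halves (h + h) → a ∈ h ∷ h + k ∷ []
      to a∈ with halves-even {h} (proj₁ (∈-halves⁻ a∈)) (proj₂ (∈-halves⁻ a∈))
      ... | inj₁ refl = here refl
      ... | inj₂ refl = there (here refl)
      from : ∀ {a} → a ∈ h ∷ h + k ∷ [] → a ∈ halves (h + h)
      from (here refl)         = ∈-halves⁺ h<d (m<n⇒m%n≡m c<d)
      from (there (here refl)) = ∈-halves⁺ h+k<d h+k-half

    double-mod-even : ∀ a → Even ((a + a) % d)
    double-mod-even a = even-cancelʳ (subst Even (m≡m%n+[m/n]*n (a + a) d) (a , refl))
      ((a + a) / d * k , trans (cong ((a + a) / d *_) d≡k+k) (*-distribˡ-+ ((a + a) / d) k k))

    length-halves-of-odd : ∀ {c} → Odd c → length (halves c) ≡ 0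
    length-halves-of-odd c-odd = cong length (filter-none (λ a → (a + a) % d ≟ _)
      (All.universal (λ a half → even⇒¬odd (subst Even half (double-mod-even a)) c-odd) (upTo d)))

-- The least period of a necklace

module Period (n : ℕ) .{{_ : NonZero n}} (r : Coloring n) where

  open Modular n
  open Action {A = Bool} n
  open Orbit n
  open import Data.List.Relation.Unary.Unique.DecPropositional.Properties (_≟C_ {n}) using (deduplicate-!)

  IsPeriod : ℕ → Set
  IsPeriod a = shift a r ≡ r

  private
    SucNotPeriod : Fin n → Set
    SucNotPeriod i = ¬ IsPeriod (suc (toℕ i))

    n-isPeriod : IsPeriod n
    n-isPeriod = shift-≈0 r d≈0

  -- Opaque: only the defining properties of the period are used, and unfolding the search is costly.
  opaque
    private
      least : ∃ λ i → ¬ SucNotPeriod i × (∀ (j : Fin (toℕ i)) → SucNotPeriod (inject j))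
      least = ¬∀⟶∃¬-smallest n SucNotPeriod (λ i → ¬? (shift (suc (toℕ i)) r ≟C r))
                (λ all → all (fromℕ< n-1<n) (subst IsPeriod (sym suc-n-1≡n) n-isPeriod))
        where
        n-1<n : pred n < n
        n-1<n = ≤-reflexive (suc-pred n)
        suc-n-1≡n : suc (toℕ (fromℕ< n-1<n)) ≡ n
        suc-n-1≡n = trans (cong suc (toℕ-fromℕ< n-1<n)) (suc-pred n)

    period : ℕ
    period = suc (toℕ (proj₁ least))

    instance
      period-nonZero : NonZero period
      period-nonZero = _

    period-isPeriod : IsPeriod period
    period-isPeriod = decidable-stable (shift period r ≟C r) (proj₁ (proj₂ least))

    period-minimal : ∀ {t} → 0 < t → t < period → ¬ IsPeriod t
    period-minimal {suc t} _ t<period =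
      subst (¬_ ∘ IsPeriod ∘ suc) (trans (toℕ-inject j) (toℕ-fromℕ< _)) (proj₂ (proj₂ least) j)
      where
      j : Fin (toℕ (proj₁ least))
      j = fromℕ< (s≤s⁻¹ t<period)

  module P = Modular period

  isPeriod-+ : ∀ {a b} → IsPeriod a → IsPeriod b → IsPeriod (a + b)
  isPeriod-+ {a} {b} a-period b-period = trans (sym (shift-shift a b r)) (trans (cong (shift a) b-period) a-period)

  isPeriod-* : ∀ q → IsPeriod (q * period)
  isPeriod-* zero    = shift-≈0 r refl
  isPeriod-* (suc q) = isPeriod-+ period-isPeriod (isPeriod-* q)

  shift-%-period : ∀ a → shift a r ≡ shift (a % period) r
  shift-%-period a = begin
    shift a r                                           ≡⟨ cong (λ b → shift b r) (m≡m%n+[m/n]*n a period) ⟩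
    shift (a % period + a / period * period) r          ≡⟨ shift-shift (a % period) _ r ⟨
    shift (a % period) (shift (a / period * period) r)  ≡⟨ cong (shift (a % period)) (isPeriod-* (a / period)) ⟩
    shift (a % period) r                                ∎
    where open ≡-Reasoning

  isPeriod⇒%≡0 : ∀ {a} → IsPeriod a → a % period ≡ 0
  isPeriod⇒%≡0 {a} a-period with a % period in eq
  ... | zero  = refl
  ... | suc t = contradiction remainder-isPeriod (period-minimal (s≤s z≤n) (subst (_< period) eq (m%n<n a period)))
    where
    remainder-isPeriod : IsPeriod (suc t)
    remainder-isPeriod = trans (cong (λ b → shift b r) (sym eq)) (trans (sym (shift-%-period a)) a-period)

  period∣n : period ∣ n
  period∣n = m%n≡0⇒n∣m n period (isPeriod⇒%≡0 n-isPeriod)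

  ≈⇒shift-≡ : ∀ {a b} → a P.≈ b → shift a r ≡ shift b r
  ≈⇒shift-≡ {a} {b} a≈b =
    trans (shift-%-period a) (trans (cong (λ c → shift c r) a≈b) (sym (shift-%-period b)))

  private
    shift-≡⇒≈-≤ : ∀ {a b} → a ≤ b → shift a r ≡ shift b r → a P.≈ b
    shift-≡⇒≈-≤ {a} a≤b eq with m≤n⇒∃[o]m+o≡n a≤b
    ... | t , refl = sym (%-remove-+ʳ a (m%n≡0⇒n∣m t period (isPeriod⇒%≡0 t-period)))
      where
      t-period : IsPeriod t
      t-period = sym (shift-injective a (trans eq (sym (shift-shift a t r))))

  shift-≡⇒≈ : ∀ {a b} → shift a r ≡ shift b r → a P.≈ b
  shift-≡⇒≈ {a} {b} eq with ≤-total a b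
  ... | inj₁ a≤b = shift-≡⇒≈-≤ a≤b eq
  ... | inj₂ b≤a = sym (shift-≡⇒≈-≤ b≤a (sym eq))

  orbit : List (Coloring n)
  orbit = applyUpTo (λ a → shift a r) period

  orbit-unique : Unique orbit
  orbit-unique = Unique.applyUpTo⁺₁ (λ a → shift a r) period
    (λ i<j j<period eq → <-irrefl (P.≈⇒≡ (<-trans i<j j<period) j<period (shift-≡⇒≈ eq)) i<j)

  ∈-orbit⁺ : ∀ {x} → Shifted r x → x ∈ orbit
  ∈-orbit⁺ (a , refl) =
    subst (_∈ orbit) (sym (shift-%-period a)) (∈-applyUpTo⁺ (λ a → shift a r) (m%n<n a period))

  ∈-orbit⁻ : ∀ {x} → x ∈ orbit → Shifted r x
  ∈-orbit⁻ x∈ with ∈-applyUpTo⁻ (λ a → shift a r) x∈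
  ... | a , _ , refl = a , refl

  orbitCard≡period : orbitCard r ≡ period
  orbitCard≡period = trans
    (unique∧set⇒length≡ (deduplicate-! _) orbit-unique (∈-orbit⁺ ∘ ∈-rotations⁻) (∈-rotations⁺ ∘ ∈-orbit⁻))
    (length-applyUpTo (λ a → shift a r) period)

  length-flipFixed-orbit : length (filter flipFixed? orbit) ≡
                           length (filter (flipFixed? ∘ (λ a → shift a r)) (upTo period))
  length-flipFixed-orbit = trans (cong (length ∘ filter flipFixed?) (sym (map-upTo (λ a → shift a r) period)))
                                 (length-filter-map flipFixed? (λ a → shift a r) (upTo period))

  length-flipFixed-orbit≡0 : ¬ HasAxis r → length (filter flipFixed? orbit) ≡ 0
  length-flipFixed-orbit≡0 no-axis = cong length (filter-none flipFixed? (All.tabulate (λ x∈ fixed →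
    no-axis (hasAxis-respects (shifted-sym (∈-orbit⁻ x∈)) (0 , fixed)))))

  module Axis {c₀} (c₀-axis : mirror c₀ r ≡ r) where

    open import Algebra.Properties.AbelianGroup P.+-abelianGroup using (⁻¹-injective; ∙-cancelˡ; ∙-cancelʳ)
    open AbelianGroup +-abelianGroup using (assoc; inverseˡ; identityʳ)

    mirror-as-shift : ∀ c → mirror c r ≡ shift (c₀ + - c) r
    mirror-as-shift c = trans (cong (mirror c) (sym c₀-axis)) (mirror-mirror c c₀ r)

    mirror-≡⇒≈ : ∀ {c c′} → mirror c r ≡ mirror c′ r → c P.≈ c′
    mirror-≡⇒≈ {c} {c′} eq = ⁻¹-injective {c} {c′} (begin
      P.- c     ≈⟨ -‿mod-divisor period∣n c ⟨
      - c       ≈⟨ ∙-cancelˡ c₀ (- c) (- c′) (shift-≡⇒≈ shifts≡) ⟩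
      - c′      ≈⟨ -‿mod-divisor period∣n c′ ⟩
      P.- c′    ∎)
      where
      open import Relation.Binary.Reasoning.Setoid (AbelianGroup.setoid P.+-abelianGroup)
      shifts≡ : shift (c₀ + - c) r ≡ shift (c₀ + - c′) r
      shifts≡ = trans (sym (mirror-as-shift c)) (trans eq (mirror-as-shift c′))

    mirror-≈⇒≡ : ∀ {c c′} → c P.≈ c′ → mirror c r ≡ mirror c′ r
    mirror-≈⇒≡ {c} {c′} c≈c′ = begin
      mirror c r                ≡⟨ mirror-as-shift c ⟩
      shift (c₀ + - c) r        ≡⟨ ≈⇒shift-≡ (P.+-congˡ c₀ -c≈-c′) ⟩
      shift (c₀ + - c′) r       ≡⟨ mirror-as-shift c′ ⟨
      mirror c′ r               ∎
      where
      open ≡-Reasoning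
      -c≈-c′ : - c P.≈ - c′
      -c≈-c′ = trans (-‿mod-divisor period∣n c) (trans (P.-‿cong {c} {c′} c≈c′) (sym (-‿mod-divisor period∣n c′)))

    private
      c₀-a+a≈c₀ : ∀ a → c₀ + - a + a P.≈ c₀
      c₀-a+a≈c₀ a = ≈-mod-divisor period∣n (trans (assoc c₀ (- a) a) (trans (+-congˡ c₀ (inverseˡ a)) (identityʳ c₀)))

    flipFixed-shift⇒ : ∀ {a} → flip (shift a r) ≡ shift a r → a + a P.≈ c₀
    flipFixed-shift⇒ {a} fixed = trans (P.+-congʳ a {a} {c₀ + - a} (mirror-≡⇒≈ (begin
      mirror a r                  ≡⟨ mirror-shift 0 a r ⟨
      flip (shift a r)            ≡⟨ fixed ⟩
      shift a r                   ≡⟨ cong (shift a) c₀-axis ⟨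
      shift a (mirror c₀ r)       ≡⟨ shift-mirror a c₀ r ⟩
      mirror (c₀ + - a) r         ∎))) (c₀-a+a≈c₀ a)
      where open ≡-Reasoning

    flipFixed-shift⇐ : ∀ {a} → a + a P.≈ c₀ → flip (shift a r) ≡ shift a r
    flipFixed-shift⇐ {a} a+a≈c₀ = begin
      flip (shift a r)            ≡⟨ mirror-shift 0 a r ⟩
      mirror a r                  ≡⟨ mirror-≈⇒≡ (∙-cancelʳ a a (c₀ + - a) (trans a+a≈c₀ (sym (c₀-a+a≈c₀ a)))) ⟩
      mirror (c₀ + - a) r         ≡⟨ shift-mirror a c₀ r ⟨
      shift a (mirror c₀ r)       ≡⟨ cong (shift a) c₀-axis ⟩
      shift a r                   ∎
      where open ≡-Reasoning

    length-flipFixed-orbit≡halves : length (filter flipFixed? orbit) ≡ length (Halves.halves period (c₀ % period))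
    length-flipFixed-orbit≡halves = trans length-flipFixed-orbit (cong length
      (filter-≐ (flipFixed? ∘ (λ a → shift a r)) (λ a → (a + a) % period ≟ c₀ % period)
                (flipFixed-shift⇒ , flipFixed-shift⇐) (upTo period)))

    hasEvenAxis⇒half : HasEvenAxis r → ∃ λ h → h + h P.≈ c₀
    hasEvenAxis⇒half (h , fixed) = h , mirror-≡⇒≈ {h + h} (trans fixed (sym c₀-axis))

    half⇒hasEvenAxis : ∀ {h} → h + h P.≈ c₀ → HasEvenAxis r
    half⇒hasEvenAxis {h} h+h≈c₀ = h , trans (mirror-≈⇒≡ h+h≈c₀) c₀-axis

-- Flip-fixed necklaces are palindromes

module _ (h : ℕ) where

  open Orbit (suc h + suc h) using (flipFixed?)

  palindrome : Coloring (suc h) → Coloring (suc h + suc h)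
  palindrome (a ∷ w) = a ∷ (w ++ (a ∷ reverse w))

  blue-palindrome : ∀ u → blue (palindrome u) ≡ blue u + blue u
  blue-palindrome (a ∷ w) = begin
    blue (palindrome (a ∷ w))                        ≡⟨ blue-∷-++-∷-reverse a a w ⟩
    (blue (a ∷ []) + blue (a ∷ [])) + (blue w + blue w) ≡⟨ interchange (blue (a ∷ [])) _ _ _ ⟩
    (blue (a ∷ []) + blue w) + (blue (a ∷ []) + blue w) ≡⟨ cong₂ _+_ (blue-∷ a w) (blue-∷ a w) ⟨
    blue (a ∷ w) + blue (a ∷ w)                      ∎
    where open ≡-Reasoning

  flip-palindrome : ∀ u → flip (palindrome u) ≡ palindrome u
  flip-palindrome (a ∷ w) = begin
    flip (a ∷ (w ++ (a ∷ reverse w)))          ≡⟨ mirror-0-∷ a (w ++ (a ∷ reverse w)) ⟩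
    a ∷ reverse (w ++ (a ∷ reverse w))         ≡⟨ cong (a ∷_) (reverse-++-∷ w (reverse w) a) ⟩
    a ∷ (reverse (reverse w) ++ (a ∷ reverse w)) ≡⟨ cong (λ v → a ∷ (v ++ (a ∷ reverse w))) (reverse-involutive w) ⟩
    a ∷ (w ++ (a ∷ reverse w))                 ∎
    where open ≡-Reasoning

  palindrome-injective : ∀ {u v} → palindrome u ≡ palindrome v → u ≡ v
  palindrome-injective {a ∷ w} {b ∷ w′} eq with ∷-injective eq
  ... | refl , eq′ = cong (a ∷_) (++-injectiveˡ w w′ eq′)

  flipFixed⇒palindrome : ∀ x → flip x ≡ x → Even (blue x) → ∃ λ u → x ≡ palindrome u
  flipFixed⇒palindrome (a ∷ u) fixed blue-even with splitAt h u
  ... | w , b ∷ w′ , refl = same-ends a b (subst (λ z → Even (blue (a ∷ (w ++ (b ∷ z))))) w′≡reverse-w blue-even)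
    where
    reverse-u : reverse (w ++ (b ∷ w′)) ≡ w ++ (b ∷ w′)
    reverse-u = ∷-injectiveʳ (trans (sym (mirror-0-∷ a (w ++ (b ∷ w′)))) fixed)
    w′≡reverse-w : w′ ≡ reverse w
    w′≡reverse-w = sym (∷-injectiveʳ (++-injectiveʳ (reverse w′) w (trans (sym (reverse-++-∷ w w′ b)) reverse-u)))
    same-ends : ∀ a b → Even (blue (a ∷ (w ++ (b ∷ reverse w)))) → ∃ λ u → a ∷ (w ++ (b ∷ w′)) ≡ palindrome u
    same-ends true  true  _    = true ∷ w , cong (λ z → true ∷ (w ++ (true ∷ z))) w′≡reverse-w
    same-ends false false _    = false ∷ w , cong (λ z → false ∷ (w ++ (false ∷ z))) w′≡reverse-w
    same-ends true  false even = ⊥-elim (even⇒¬odd (subst Even (blue-∷-++-∷-reverse true false w) even) (blue w , refl))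
    same-ends false true  even = ⊥-elim (even⇒¬odd (subst Even (blue-∷-++-∷-reverse false true w) even) (blue w , refl))

  length-flipFixed-Neck : ∀ t → length (filter flipFixed? (Neck (suc h + suc h) (t + t))) ≡ suc h C t
  length-flipFixed-Neck t = begin
    length (filter flipFixed? (Neck (suc h + suc h) (t + t)))
      ≡⟨ unique∧set⇒length≡ (Unique.filter⁺ flipFixed? (Neck-unique _ (t + t)))
                            (Unique.map⁺ palindrome-injective (Neck-unique (suc h) t)) to from ⟩
    length (map palindrome (Neck (suc h) t))
      ≡⟨ List.length-map palindrome (Neck (suc h) t) ⟩
    length (Neck (suc h) t)
      ≡⟨ length-Neck (suc h) t ⟩
    suc h C t
      ∎
    where
    open ≡-Reasoning
    to : ∀ {x} → x ∈ filter flipFixed? (Neck (suc h + suc h) (t + t)) → x ∈ map palindrome (Neck (suc h) t)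
    to {x} x∈ with ∈-filter⁻ flipFixed? {xs = Neck _ (t + t)} x∈
    ... | x∈Neck , fixed with flipFixed⇒palindrome x fixed (t , ∈-Neck⁻ x∈Neck)
    ...   | u , refl = ∈-map⁺ palindrome (∈-Neck⁺ (double-injective (trans (sym (blue-palindrome u)) (∈-Neck⁻ x∈Neck))))
    from : ∀ {x} → x ∈ map palindrome (Neck (suc h) t) → x ∈ filter flipFixed? (Neck (suc h + suc h) (t + t))
    from x∈ with ∈-map⁻ palindrome x∈
    ... | u , u∈Neck , refl = ∈-filter⁺ flipFixed? (∈-Neck⁺ blue≡t+t) (flip-palindrome u)
      where
      blue≡t+t : blue (palindrome u) ≡ t + t
      blue≡t+t = trans (blue-palindrome u) (cong₂ _+_ (∈-Neck⁻ u∈Neck) (∈-Neck⁻ u∈Neck))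

-- Orbit-wise double counting

module Counting (n : ℕ) .{{_ : NonZero n}} where

  open Modular n
  open Action {A = Bool} n
  open Orbit n

  isF2? : (v : Coloring n) → Dec (FFixed v × HasType2Rep v)
  isF2? v = fFixed? v ×-dec hasType2Rep? v

  isOddF? : (v : Coloring n) → Dec (FFixed v × ¬ 2 ∣ orbitCard v)
  isOddF? v = fFixed? v ×-dec ¬? (2 ∣? orbitCard v)

  module _ {r : Coloring n} {c₀ : ℕ} (c₀-axis : mirror c₀ r ≡ r) where

    open Period n r
    open Axis c₀-axis
    open Halves period using (halves; half-exists; length-halves-odd; length-halves-even; length-halves-of-odd; double-mod-even)

    private
      fixed : FFixed r
      fixed = hasAxis⇒fFixed {r} (c₀ , c₀-axis)

      c<period : c₀ % period < period
      c<period = m%n<n c₀ period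

      even-period⇒¬isOddF : Even period → ¬ (FFixed r × ¬ 2 ∣ orbitCard r)
      even-period⇒¬isOddF period-even (_ , odd-card) = odd-card (subst (2 ∣_) (sym orbitCard≡period) (even⇒2∣ period-even))

    orbit-identity-odd : Odd period → 2 * 𝟙 (isF2? r) ≡ length (filter flipFixed? orbit) + 𝟙 (isOddF? r)
    orbit-identity-odd period-odd = begin
      2 * 𝟙 (isF2? r)                                    ≡⟨ cong (2 *_) (𝟙-yes (isF2? r) (fixed , type2)) ⟩
      1 + 1                                              ≡⟨ cong₂ _+_ one-flipFixed (𝟙-yes (isOddF? r) (fixed , odd-card)) ⟨
      length (filter flipFixed? orbit) + 𝟙 (isOddF? r)   ∎
      where
      open ≡-Reasoning
      type2 : HasType2Rep r
      type2 = let a , _ , half = half-exists period-odd c<period in hasEvenAxis⇒hasType2Rep (half⇒hasEvenAxis {a} half)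
      odd-card : ¬ 2 ∣ orbitCard r
      odd-card 2∣card = even⇒¬odd (2∣⇒even (subst (2 ∣_) orbitCard≡period 2∣card)) period-odd
      one-flipFixed : length (filter flipFixed? orbit) ≡ 1
      one-flipFixed = trans length-flipFixed-orbit≡halves (length-halves-odd period-odd c<period)

    orbit-identity-even-even : Even period → Even (c₀ % period) →
                               2 * 𝟙 (isF2? r) ≡ length (filter flipFixed? orbit) + 𝟙 (isOddF? r)
    orbit-identity-even-even period-even@(k , period≡k+k) (h , c≡h+h) = begin
      2 * 𝟙 (isF2? r)                                    ≡⟨ cong (2 *_) (𝟙-yes (isF2? r) (fixed , type2)) ⟩
      2 + 0                                              ≡⟨ cong₂ _+_ two-flipFixed (𝟙-no (isOddF? r) (even-period⇒¬isOddF period-even)) ⟨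
      length (filter flipFixed? orbit) + 𝟙 (isOddF? r)   ∎
      where
      open ≡-Reasoning
      type2 : HasType2Rep r
      type2 = hasEvenAxis⇒hasType2Rep (half⇒hasEvenAxis {h} (trans (cong (_% period) (sym c≡h+h)) (P.%≈ c₀)))
      two-flipFixed : length (filter flipFixed? orbit) ≡ 2
      two-flipFixed = trans length-flipFixed-orbit≡halves (subst (λ c → length (halves c) ≡ 2) (sym c≡h+h)
        (length-halves-even {k} period≡k+k {h} (subst (_< period) c≡h+h c<period)))

    orbit-identity-even-odd : Even period → Odd (c₀ % period) →
                              2 * 𝟙 (isF2? r) ≡ length (filter flipFixed? orbit) + 𝟙 (isOddF? r)
    orbit-identity-even-odd period-even@(k , period≡k+k) c-odd = begin
      2 * 𝟙 (isF2? r)                                    ≡⟨ cong (2 *_) (𝟙-no (isF2? r) (no-type2 ∘ proj₂)) ⟩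
      0 + 0                                              ≡⟨ cong₂ _+_ no-flipFixed (𝟙-no (isOddF? r) (even-period⇒¬isOddF period-even)) ⟨
      length (filter flipFixed? orbit) + 𝟙 (isOddF? r)   ∎
      where
      open ≡-Reasoning
      no-half : ∀ h → h + h P.≈ c₀ → ⊥
      no-half h h+h≈c₀ = even⇒¬odd (subst Even h+h≈c₀ (double-mod-even {k} period≡k+k h)) c-odd
      no-type2 : ¬ HasType2Rep r
      no-type2 type2 = uncurry no-half (hasEvenAxis⇒half (hasType2Rep⇒hasEvenAxis type2))
      no-flipFixed : length (filter flipFixed? orbit) ≡ 0
      no-flipFixed = trans length-flipFixed-orbit≡halves (length-halves-of-odd {k} period≡k+k c-odd)

    orbit-identity-fixed : 2 * 𝟙 (isF2? r) ≡ length (filter flipFixed? orbit) + 𝟙 (isOddF? r)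
    orbit-identity-fixed with even-or-odd period | even-or-odd (c₀ % period)
    ... | inj₂ period-odd  | _          = orbit-identity-odd period-odd
    ... | inj₁ period-even | inj₁ c-even = orbit-identity-even-even period-even c-even
    ... | inj₁ period-even | inj₂ c-odd  = orbit-identity-even-odd period-even c-odd

  orbit-identity : ∀ r → 2 * 𝟙 (isF2? r) ≡ length (filter flipFixed? (Period.orbit n r)) + 𝟙 (isOddF? r)
  orbit-identity r = by-fixedness (fFixed? r)
    where
    by-fixedness : Dec (FFixed r) → 2 * 𝟙 (isF2? r) ≡ length (filter flipFixed? (Period.orbit n r)) + 𝟙 (isOddF? r)
    by-fixedness (yes fixed) = orbit-identity-fixed (proj₂ (fFixed⇒hasAxis {r} fixed))
    by-fixedness (no ¬fixed) = begin
      2 * 𝟙 (isF2? r)   ≡⟨ cong (2 *_) (𝟙-no (isF2? r) (¬fixed ∘ proj₁)) ⟩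
      0 + 0             ≡⟨ cong₂ _+_ (Period.length-flipFixed-orbit≡0 n r (¬fixed ∘ hasAxis⇒fFixed {r}))
                                     (𝟙-no (isOddF? r) (¬fixed ∘ proj₁)) ⟨
      length (filter flipFixed? (Period.orbit n r)) + 𝟙 (isOddF? r)  ∎
      where open ≡-Reasoning

  fFixed-respects : FFixed Respects SameOrbit
  fFixed-respects {v} {w} v∼w fixed =
    hasAxis⇒fFixed {w} (hasAxis-respects (sameOrbit⇒shifted {v} v∼w) (fFixed⇒hasAxis {v} fixed))

  isF2-respects : (λ v → FFixed v × HasType2Rep v) Respects SameOrbit
  isF2-respects {v} v∼w (fixed , type2) = fFixed-respects {v} v∼w fixed ,
    hasEvenAxis⇒hasType2Rep (hasEvenAxis-respects (sameOrbit⇒shifted {v} v∼w) (hasType2Rep⇒hasEvenAxis type2))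

  isOddF-respects : (λ v → FFixed v × ¬ 2 ∣ orbitCard v) Respects SameOrbit
  isOddF-respects {v} v∼w (fixed , odd-card) = fFixed-respects {v} v∼w fixed ,
    odd-card ∘ subst (2 ∣_) (sym (orbitCard-cong (sameOrbit⇒shifted {v} v∼w)))

  module _ (j : ℕ) where

    open Classes sameOrbit-decSetoid

    class-size≡orbit : ∀ {r} → blue r ≡ j →
                       class-size flipFixed? (Neck n j) r ≡ length (filter flipFixed? (Period.orbit n r))
    class-size≡orbit {r} blue≡j = unique∧set⇒length≡
      (Unique.filter⁺ flipFixed? (Unique.filter⁺ (sameOrbit? r) (Neck-unique n j)))
      (Unique.filter⁺ flipFixed? orbit-unique) to from
      where
      open Period n r using (orbit; orbit-unique; ∈-orbit⁺; ∈-orbit⁻)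
      to : ∀ {x} → x ∈ filter flipFixed? (filter (sameOrbit? r) (Neck n j)) → x ∈ filter flipFixed? orbit
      to x∈ with ∈-filter⁻ flipFixed? {xs = filter (sameOrbit? r) (Neck n j)} x∈
      ... | x∈class , fixed with ∈-filter⁻ (sameOrbit? r) {xs = Neck n j} x∈class
      ...   | _ , r∼x = ∈-filter⁺ flipFixed? (∈-orbit⁺ (sameOrbit⇒shifted {r} r∼x)) fixed
      from : ∀ {x} → x ∈ filter flipFixed? orbit → x ∈ filter flipFixed? (filter (sameOrbit? r) (Neck n j))
      from x∈ with ∈-filter⁻ flipFixed? {xs = orbit} x∈
      ... | x∈orbit , fixed with ∈-orbit⁻ x∈orbit
      ...   | a , refl = ∈-filter⁺ flipFixed? (∈-filter⁺ (sameOrbit? r) x∈Neck (shifted⇒sameOrbit {r} (a , refl))) fixed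
        where
        x∈Neck : shift a r ∈ Neck n j
        x∈Neck = ∈-Neck⁺ (trans (blue-shift a r) blue≡j)

    orbit-count-identity : 2 * numOrbF2 {n} j ≡ length (filter flipFixed? (Neck n j)) + numOrbOddF {n} j
    orbit-count-identity = begin
      2 * numOrbF2 j
        ≡⟨ cong (λ vs → 2 * length vs) (dedup-filter isF2? (λ {v} {w} → isF2-respects {v} {w}) (Neck n j)) ⟩
      2 * length (filter isF2? orbits)
        ≡⟨ count-double isF2? isOddF? flipFixedInClass (All.map (λ {r} → identity {r}) orbits-blue) ⟩
      sum (map flipFixedInClass orbits) + length (filter isOddF? orbits)
        ≡⟨ cong₂ _+_ (length-filter≡sum-classes flipFixed? (Neck n j))
                     (cong length (dedup-filter isOddF? (λ {v} {w} → isOddF-respects {v} {w}) (Neck n j))) ⟨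
      length (filter flipFixed? (Neck n j)) + numOrbOddF j
        ∎
      where
      open ≡-Reasoning
      orbits = dedup (Neck n j)
      flipFixedInClass = class-size flipFixed? (Neck n j)
      orbits-blue : All (λ r → blue r ≡ j) orbits
      orbits-blue = deduplicate⁺ sameOrbit? (all-filter (λ v → blue v ≟ j) (allColorings n))
      identity : ∀ {r} → blue r ≡ j → 2 * 𝟙 (isF2? r) ≡ flipFixedInClass r + 𝟙 (isOddF? r)
      identity {r} blue≡j = trans (orbit-identity r) (cong (_+ 𝟙 (isOddF? r)) (sym (class-size≡orbit blue≡j)))

proposition3p25 : (n j : ℕ) .{{_ : NonZero n}} → 4 ∣ n → 2 ∣ j → 2 ≤ j → j ≤ n →
    2 * numOrbF2 {n} j ≡ ((n / 2) C (j / 2)) + numOrbOddF {n} j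
proposition3p25 (suc m) j 4∣n 2∣j _ _ with 2∣⇒even (∣-trans (divides 2 refl) 4∣n) | 2∣⇒even 2∣j
... | zero  , ()   | _
... | suc h , refl | t , refl = begin
  2 * numOrbF2 (t + t)
    ≡⟨ Counting.orbit-count-identity N (t + t) ⟩
  length (filter (Orbit.flipFixed? N) (Neck N (t + t))) + numOrbOddF (t + t)
    ≡⟨ cong (_+ numOrbOddF (t + t)) (length-flipFixed-Neck h t) ⟩
  suc h C t + numOrbOddF (t + t)
    ≡⟨ cong₂ (λ a b → a C b + numOrbOddF (t + t)) (double/2 (suc h)) (double/2 t) ⟨
  ((N / 2) C ((t + t) / 2)) + numOrbOddF (t + t)
    ∎
  where
  open ≡-Reasoning
  N = suc h + suc h
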